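{- (1) If $n=3$ or $n=4$, then $l_0^{(n-1)^3}(n^3)>\frac{(n!)^{2n}}{n^{n^2}}$. (2) If $n\ge 5$ is an integer, then $l_0^{(n-1)^3}(n^3)<\frac{(n!)^{2n}}{n^{n^2}}$.
   Context: For a positive integer $d$ and integer $m$, define $$u_0^d(m)=\binom{m-\lfloor \frac{d}{2}\rfloor -1}{\lfloor \frac{d-1}{2}\rfloor}+\binom{m-\lfloor \frac{d-1}{2}\rfloor -1}{\lfloor \frac{d}{2}\rfloor},$$ and for a positive integer $x$ define $l_0^d(x)=k$ if and only if $k$ is the integer with $u_0^d(k-1)<x\leq u_0^d(k)$. -}

module Defs where

open import Data.Nat as ℕ using (ℕ; _∸_; _/_)
open import Data.Nat.Combinatorics using (_C_)
open import Data.Integer as ℤ using (ℤ; +_; -[1+_]; _-_; _<_; _≤_)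
open import Data.Product using (_×_)

binomℤ : ℤ → ℕ → ℕ
binomℤ (+ a)    b = a C b
binomℤ -[1+ _ ] b = 0

-- u_0^d(m) = C(m - ⌊d/2⌋ - 1, ⌊(d-1)/2⌋) + C(m - ⌊(d-1)/2⌋ - 1, ⌊d/2⌋)
-- (d is a positive integer, so d ∸ 1 = d - 1).
u0 : ℕ → ℤ → ℕ
u0 d m = binomℤ (m - + (d / 2) - + 1) ((d ∸ 1) / 2)
   ℕ.+ binomℤ (m - + ((d ∸ 1) / 2) - + 1) (d / 2)

IsL0 : ℕ → ℕ → ℤ → Set
IsL0 d x k = (+ u0 d (k - + 1) < + x) × (+ x ≤ + u0 d k)

-- Since ⌊d/2⌋ + ⌊(d-1)/2⌋ = d - 1, both binomials in u₀ᵈ(m) vanish for m < d, while for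
-- m ≥ d + x the second one is C(a, ⌊d/2⌋) with a ≥ ⌊d/2⌋ + x, hence at least x.  So for
-- d ≥ 2 and x ≥ 1 the value u₀ᵈ(m) crosses x somewhere in [0, d + x], l₀ᵈ(x) exists, and
-- d ≤ l₀ᵈ(x) ≤ d + x.  For d = (n-1)³ and x = n³ the lower bound already exceeds
-- (n!)^(2n)/n^(n²) when n = 3, 4; for n ≥ 5 the upper bound 2n³ stays below it because
-- 2n³ < 4ⁿ and 4nⁿ ≤ (n!)² (the latter for n ≥ 9; n = 5, …, 8 are checked numerically).
module Submission where

open import Defs
open import Data.Nat
open import Data.Nat.Properties
open import Data.Nat.Combinatorics using (_C_; k>n⇒nCk≡0; nCk+nC[k+1]≡[n+1]C[k+1]; nCk≡nC[n∸k]; nCn≡1)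
open import Data.Nat.DivMod using (m/n≡1+[m∸n]/n; m≥n⇒m/n>0)
open import Data.Nat.Tactic.RingSolver using (solve-∀)
open import Data.Nat.Solver using (module +-*-Solver)
open +-*-Solver using (solve; _:+_; _:*_; _:^_; _:=_; con)
open import Data.Integer as ℤ using (ℤ; +_; -[1+_]; _⊖_; +≤+; +<+; -≤+)
import Data.Integer.Properties as ℤ
import Data.Integer.Tactic.RingSolver as ℤ-Solver
open import Data.Product using (_×_; _,_; ∃)
open import Data.Sum using (_⊎_; inj₁; inj₂)
open import Relation.Nullary using (yes; no; contradiction)
open import Relation.Binary.PropositionalEquality

n/2≡⌊n/2⌋ : ∀ n → n / 2 ≡ ⌊ n /2⌋
n/2≡⌊n/2⌋ zero          = refl
n/2≡⌊n/2⌋ (suc zero)    = refl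
n/2≡⌊n/2⌋ (suc (suc n)) = trans (m/n≡1+[m∸n]/n {suc (suc n)} {2} (s≤s (s≤s z≤n))) (cong suc (n/2≡⌊n/2⌋ n))

[1+n]/2+n/2≡n : ∀ n → suc n / 2 + n / 2 ≡ n
[1+n]/2+n/2≡n n rewrite n/2≡⌊n/2⌋ (suc n) | n/2≡⌊n/2⌋ n =
  trans (+-comm ⌈ n /2⌉ ⌊ n /2⌋) (⌊n/2⌋+⌈n/2⌉≡n n)

0<nCk : ∀ {n k} → k ≤ n → 0 < n C k
0<nCk {n} {zero} _ = subst (0 <_) (sym (trans (nCk≡nC[n∸k] {0} {n} z≤n) (nCn≡1 n))) z<s
0<nCk {suc n} {suc k} (s≤s k≤n) =
  subst (0 <_) (nCk+nC[k+1]≡[n+1]C[k+1] n k) (≤-trans (0<nCk k≤n) (m≤m+n _ _))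

m≤[1+k+m]C[1+k] : ∀ k m → m ≤ (suc k + m) C suc k
m≤[1+k+m]C[1+k] k zero    = z≤n
m≤[1+k+m]C[1+k] k (suc m) =
  subst (suc m ≤_) (nCk+nC[k+1]≡[n+1]C[k+1] (k + suc m) k)
    (+-mono-≤ (0<nCk (m≤m+n k (suc m))) ih)
  where
  ih : m ≤ (k + suc m) C suc k
  ih = subst (λ a → m ≤ a C suc k) (sym (+-suc k m)) (m≤[1+k+m]C[1+k] k m)

m≤nCk : ∀ {m n k} → 1 ≤ k → k + m ≤ n → m ≤ n C k
m≤nCk {m} {n} {suc k} _ k+m≤n = subst (λ a → m ≤ a C suc k) k+[m+r]≡n
  (≤-trans (m≤m+n m r) (m≤[1+k+m]C[1+k] k (m + r)))
  where
  r = n ∸ (suc k + m)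
  k+[m+r]≡n : suc k + (m + r) ≡ n
  k+[m+r]≡n = trans (sym (+-assoc (suc k) m r)) (m+[n∸m]≡n k+m≤n)

binomℤ-≥ : ∀ {m n} k → n ≤ m → binomℤ (m ⊖ n) k ≡ (m ∸ n) C k
binomℤ-≥ k n≤m rewrite ℤ.≤-⊖ n≤m = refl

binomℤ-neg : ∀ {t} k → 0 < t → binomℤ (ℤ.- + t) k ≡ 0
binomℤ-neg {suc t} k _ = refl

binomℤ-< : ∀ {m n k} → m < n + k → binomℤ (m ⊖ n) k ≡ 0
binomℤ-< {m} {n} {k} m<n+k with n ≤? m
... | yes n≤m = trans (binomℤ-≥ k n≤m) (k>n⇒nCk≡0 m∸n<k)
  where
  m∸n<k : m ∸ n < k
  m∸n<k = subst (m ∸ n <_) (m+n∸m≡n n k) (∸-monoˡ-< m<n+k n≤m)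
... | no n≰m rewrite ℤ.⊖-≰ n≰m = binomℤ-neg k (m<n⇒0<n∸m (≰⇒> n≰m))

i-m-1≡i-[1+m] : ∀ i m → i ℤ.- + m ℤ.- + 1 ≡ i ℤ.- + suc m
i-m-1≡i-[1+m] i m = trans (reassoc i (+ m) (+ 1)) (cong (λ j → i ℤ.- j) (sym (ℤ.pos-+ 1 m)))
  where
  reassoc : ∀ i a b → i ℤ.- a ℤ.- b ≡ i ℤ.- (b ℤ.+ a)
  reassoc = ℤ-Solver.solve-∀

u0-pos : ∀ d m → u0 d (+ m) ≡ binomℤ (m ⊖ suc (d / 2)) ((d ∸ 1) / 2) + binomℤ (m ⊖ suc ((d ∸ 1) / 2)) (d / 2)
u0-pos d m
  rewrite i-m-1≡i-[1+m] (+ m) (d / 2) | i-m-1≡i-[1+m] (+ m) ((d ∸ 1) / 2)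
        | ℤ.[+m]-[+n]≡m⊖n m (suc (d / 2)) | ℤ.[+m]-[+n]≡m⊖n m (suc ((d ∸ 1) / 2)) = refl

u0-neg : ∀ d q → u0 d -[1+ q ] ≡ 0
u0-neg d q
  rewrite i-m-1≡i-[1+m] -[1+ q ] (d / 2) | i-m-1≡i-[1+m] -[1+ q ] ((d ∸ 1) / 2) = refl

u0-< : ∀ {d m} → 1 ≤ d → m < d → u0 d (+ m) ≡ 0
u0-< {suc e} {m} _ m<d rewrite u0-pos (suc e) m =
  cong₂ _+_ (binomℤ-< {m} {suc b} {h} (subst (m <_) (cong suc (sym halves)) m<d))
            (binomℤ-< {m} {suc h} {b} (subst (m <_) (cong suc (sym (trans (+-comm h b) halves))) m<d))
  where
  b = suc e / 2
  h = e / 2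
  halves : b + h ≡ e
  halves = [1+n]/2+n/2≡n e

u0-≥ : ∀ {d x m} → 2 ≤ d → d + x ≤ m → x ≤ u0 d (+ m)
u0-≥ {suc e} {x} {m} 2≤d d+x≤m rewrite u0-pos (suc e) m =
  ≤-trans (subst (x ≤_) (sym (binomℤ-≥ {m} {suc h} b 1+h≤m)) (m≤nCk 1≤b b+x≤m∸[1+h])) (m≤n+m _ _)
  where
  b = suc e / 2
  h = e / 2
  1+h+b≡d : suc h + b ≡ suc e
  1+h+b≡d = cong suc (trans (+-comm h b) ([1+n]/2+n/2≡n e))
  1+h+[b+x]≤m : suc h + (b + x) ≤ m
  1+h+[b+x]≤m = subst (_≤ m) (trans (cong (_+ x) (sym 1+h+b≡d)) (+-assoc (suc h) b x)) d+x≤m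
  1+h≤m : suc h ≤ m
  1+h≤m = m+n≤o⇒m≤o (suc h) 1+h+[b+x]≤m
  b+x≤m∸[1+h] : b + x ≤ m ∸ suc h
  b+x≤m∸[1+h] = m+n≤o⇒m≤o∸n (b + x) (subst (_≤ m) (+-comm (suc h) (b + x)) 1+h+[b+x]≤m)
  1≤b : 1 ≤ b
  1≤b = m≥n⇒m/n>0 2≤d

crossing : ∀ (f : ℕ → ℕ) {x} N → f 0 < x → x ≤ f N → ∃ λ j → f j < x × x ≤ f (suc j)
crossing f zero    f0<x x≤fN = contradiction x≤fN (<⇒≱ f0<x)
crossing f {x} (suc N) f0<x x≤fN with x ≤? f N
... | yes x≤f = crossing f N f0<x x≤f
... | no  x≰f = N , ≰⇒> x≰f , x≤fN

l0-exists : ∀ d x → 2 ≤ d → 1 ≤ x → ∃ λ k → IsL0 d x k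
l0-exists d x 2≤d 1≤x with crossing (λ j → u0 d (+ j)) (d + x) f0<x (u0-≥ 2≤d ≤-refl)
  where
  f0<x : u0 d (+ 0) < x
  f0<x = subst (_< x) (sym (u0-< (≤-trans (s≤s z≤n) 2≤d) (≤-trans (s≤s z≤n) 2≤d))) 1≤x
... | j , fj<x , x≤f[1+j] = + suc j , +<+ fj<x , +≤+ x≤f[1+j]

IsL0⇒d≤k : ∀ d x {k} → 1 ≤ d → 1 ≤ x → IsL0 d x k → + d ℤ.≤ k
IsL0⇒d≤k d x { -[1+ q ]} 1≤d 1≤x (_ , +≤+ x≤u) = contradiction (subst (x ≤_) (u0-neg d q) x≤u) (<⇒≱ 1≤x)
IsL0⇒d≤k d x {+ m} 1≤d 1≤x (_ , +≤+ x≤u) with m <? d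
... | yes m<d = contradiction (subst (x ≤_) (u0-< 1≤d m<d) x≤u) (<⇒≱ 1≤x)
... | no  m≮d = +≤+ (≮⇒≥ m≮d)

IsL0⇒k≤d+x : ∀ d x {k} → 2 ≤ d → IsL0 d x k → k ℤ.≤ + (d + x)
IsL0⇒k≤d+x _ _ { -[1+ q ]} _ _            = -≤+
IsL0⇒k≤d+x _ _ {+ zero}    _ _            = +≤+ z≤n
IsL0⇒k≤d+x d x {+ suc m} 2≤d (+<+ u<x , _) with suc m ≤? d + x
... | yes 1+m≤d+x = +≤+ 1+m≤d+x
... | no  1+m≰d+x = contradiction (u0-≥ 2≤d (≤-pred (≰⇒> 1+m≰d+x))) (<⇒≱ u<x)

^-distribʳ-* : ∀ m n o → (m * n) ^ o ≡ m ^ o * n ^ o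
^-distribʳ-* m n zero    = refl
^-distribʳ-* m n (suc o) rewrite ^-distribʳ-* m n o = interchange m n (m ^ o) (n ^ o)
  where
  interchange : ∀ a b c d → a * b * (c * d) ≡ a * c * (b * d)
  interchange = solve-∀

[i+j]^i*j!≤i!*[i+j]! : ∀ i j → (i + j) ^ i * j ! ≤ i ! * (i + j) !
[i+j]^i*j!≤i!*[i+j]! zero    j = ≤-refl
[i+j]^i*j!≤i!*[i+j]! (suc i) j = begin
  n * n ^ i * j !                     ≤⟨ *-monoˡ-≤ (j !) (*-monoˡ-≤ (n ^ i) n≤[1+i]*[1+j]) ⟩
  suc i * suc j * n ^ i * j !         ≡⟨ regroup (suc i) (suc j) (n ^ i) (j !) ⟩
  suc i * (n ^ i * (suc j * j !))     ≤⟨ *-monoʳ-≤ (suc i) ih ⟩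
  suc i * (i ! * n !)                 ≡⟨ *-assoc (suc i) (i !) (n !) ⟨
  suc i * i ! * n !                   ∎
  where
  open ≤-Reasoning
  n = suc (i + j)
  ih : n ^ i * (suc j * j !) ≤ i ! * n !
  ih = subst (λ m → m ^ i * (suc j * j !) ≤ i ! * m !) (+-suc i j) ([i+j]^i*j!≤i!*[i+j]! i (suc j))
  expand : ∀ i j → suc (i + j) + i * j ≡ suc i * suc j
  expand = solve-∀
  n≤[1+i]*[1+j] : n ≤ suc i * suc j
  n≤[1+i]*[1+j] = subst (n ≤_) (expand i j) (m≤m+n n (i * j))
  regroup : ∀ a b c d → a * b * c * d ≡ a * (c * (b * d))
  regroup = solve-∀

2*n^3<4^n : ∀ {n} → 5 ≤ n → 2 * n ^ 3 < 4 ^ n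
2*n^3<4^n 5≤n with m≤n⇒∃[o]m+o≡n 5≤n
... | p , refl = from5 p
  where
  from5 : ∀ p → 2 * (5 + p) ^ 3 < 4 ^ (5 + p)
  from5 zero    = <ᵇ⇒< _ _ _
  from5 (suc p) = begin-strict
    2 * (6 + p) ^ 3                                             ≤⟨ m≤m+n _ _ ⟩
    2 * (6 + p) ^ 3 + (568 + 384 * p + 84 * p ^ 2 + 6 * p ^ 3)  ≡⟨ expand p ⟩
    4 * (2 * (5 + p) ^ 3)                                       <⟨ *-monoʳ-< 4 (from5 p) ⟩
    4 * 4 ^ (5 + p)                                             ∎
    where
    open ≤-Reasoning
    expand : ∀ p → 2 * (6 + p) ^ 3 + (568 + 384 * p + 84 * p ^ 2 + 6 * p ^ 3) ≡ 4 * (2 * (5 + p) ^ 3)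
    expand = solve 1 (λ p → con 2 :* (con 6 :+ p) :^ 3 :+ (con 568 :+ con 384 :* p :+ con 84 :* p :^ 2 :+ con 6 :* p :^ 3)
                              := con 4 :* (con 2 :* (con 5 :+ p) :^ 3)) refl

4*n^n≤[n!]^2 : ∀ {n} → 9 ≤ n → 4 * n ^ n ≤ (n !) ^ 2
4*n^n≤[n!]^2 9≤n with m≤n⇒∃[o]m+o≡n 9≤n
... | p , refl = begin
  4 * n ^ (3 + m)                      ≡⟨ cong (4 *_) (^-distribˡ-+-* n 3 m) ⟩
  4 * (n ^ 3 * n ^ m)                  ≡⟨ *-assoc 4 (n ^ 3) (n ^ m) ⟨
  4 * n ^ 3 * n ^ m                    ≤⟨ *-monoˡ-≤ (n ^ m) 4*n^3≤6*n[n-1][n-2] ⟩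
  6 * falling * n ^ m                  ≡⟨ rotate 6 falling (n ^ m) ⟩
  falling * (n ^ m * 3 !)              ≤⟨ *-monoʳ-≤ falling n^m*3!≤m!*n! ⟩
  falling * (m ! * n !)                ≡⟨ regroup n (2 + m) (1 + m) (m !) (n !) ⟩
  n ! * (n ! * 1)                      ∎
  where
  open ≤-Reasoning
  m = 6 + p
  n = 9 + p
  falling = n * ((2 + m) * (1 + m))
  expand : ∀ p → 4 * (9 + p) ^ 3 + 2 * (9 + p) * (p ^ 2 + 9 * p + 6) ≡ 6 * ((9 + p) * ((8 + p) * (7 + p)))
  expand = solve 1 (λ p → con 4 :* (con 9 :+ p) :^ 3 :+ con 2 :* (con 9 :+ p) :* (p :^ 2 :+ con 9 :* p :+ con 6)
                            := con 6 :* ((con 9 :+ p) :* ((con 8 :+ p) :* (con 7 :+ p)))) refl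
  4*n^3≤6*n[n-1][n-2] : 4 * n ^ 3 ≤ 6 * falling
  4*n^3≤6*n[n-1][n-2] = subst (4 * n ^ 3 ≤_) (expand p) (m≤m+n _ _)
  n^m*3!≤m!*n! : n ^ m * 3 ! ≤ m ! * n !
  n^m*3!≤m!*n! = subst (λ k → k ^ m * 3 ! ≤ m ! * k !) (+-comm m 3) ([i+j]^i*j!≤i!*[i+j]! m 3)
  rotate : ∀ a b c → a * b * c ≡ b * (c * a)
  rotate = solve-∀
  regroup : ∀ a b c d e → a * (b * c) * (d * e) ≡ a * (b * (c * d)) * (e * 1)
  regroup = solve-∀

2*n^3*n^[n*n]<n!^[2*n] : ∀ {n} → 5 ≤ n → 2 * n ^ 3 * n ^ (n * n) < (n !) ^ (2 * n)
2*n^3*n^[n*n]<n!^[2*n] 5≤n with m≤n⇒∃[o]m+o≡n 5≤n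
... | p , refl = from5 p
  where
  from5 : ∀ p → let n = 5 + p in 2 * n ^ 3 * n ^ (n * n) < (n !) ^ (2 * n)
  from5 0 = <ᵇ⇒< _ _ _
  from5 1 = <ᵇ⇒< _ _ _
  from5 2 = <ᵇ⇒< _ _ _
  from5 3 = <ᵇ⇒< _ _ _
  from5 (suc (suc (suc (suc p)))) = begin-strict
    2 * n ^ 3 * n ^ (n * n)   <⟨ *-monoˡ-< (n ^ (n * n)) {{m^n≢0 n (n * n)}} (2*n^3<4^n (m≤m+n 5 (4 + p))) ⟩
    4 ^ n * n ^ (n * n)       ≡⟨ cong (4 ^ n *_) (^-*-assoc n n n) ⟨
    4 ^ n * (n ^ n) ^ n       ≡⟨ ^-distribʳ-* 4 (n ^ n) n ⟨
    (4 * n ^ n) ^ n           ≤⟨ ^-monoˡ-≤ n (4*n^n≤[n!]^2 (m≤m+n 9 p)) ⟩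
    ((n !) ^ 2) ^ n             ≡⟨ ^-*-assoc (n !) 2 n ⟩
    (n !) ^ (2 * n)             ∎
    where
    open ≤-Reasoning
    n = 9 + p

l0-above : ∀ d x N {F} → 2 ≤ d → 1 ≤ x → F < d * N →
           ∃ (λ k → IsL0 d x k) × (∀ k → IsL0 d x k → + F ℤ.< k ℤ.* + N)
l0-above d x N {F} 2≤d 1≤x F<d*N = l0-exists d x 2≤d 1≤x , F<k*N
  where
  F<k*N : ∀ k → IsL0 d x k → + F ℤ.< k ℤ.* + N
  F<k*N k l0 = ℤ.<-≤-trans (subst (+ F ℤ.<_) (ℤ.pos-* d N) (+<+ F<d*N))
    (ℤ.*-monoʳ-≤-nonNeg (+ N) (IsL0⇒d≤k d x {k} (≤-trans (s≤s z≤n) 2≤d) 1≤x l0))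

l0-below : ∀ d x N {F} → 2 ≤ d → 1 ≤ x → (d + x) * N < F →
           ∃ (λ k → IsL0 d x k) × (∀ k → IsL0 d x k → k ℤ.* + N ℤ.< + F)
l0-below d x N {F} 2≤d 1≤x [d+x]*N<F = l0-exists d x 2≤d 1≤x , k*N<F
  where
  k*N<F : ∀ k → IsL0 d x k → k ℤ.* + N ℤ.< + F
  k*N<F k l0 = ℤ.≤-<-trans (ℤ.*-monoʳ-≤-nonNeg (+ N) (IsL0⇒k≤d+x d x {k} 2≤d l0))
    (subst (ℤ._< + F) (ℤ.pos-* (d + x) N) (+<+ [d+x]*N<F))

2≤[n∸1]^3 : ∀ {n} → 3 ≤ n → 2 ≤ (n ∸ 1) ^ 3
2≤[n∸1]^3 3≤n = ≤-trans (s≤s (s≤s z≤n)) (^-monoˡ-≤ 3 (∸-monoˡ-≤ 1 3≤n))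

[n∸1]^k+n^k≤2*n^k : ∀ n k → (n ∸ 1) ^ k + n ^ k ≤ 2 * n ^ k
[n∸1]^k+n^k≤2*n^k n k = +-mono-≤ (^-monoˡ-≤ k (m∸n≤m n 1)) (≤-reflexive (sym (+-identityʳ (n ^ k))))

proposition8 :
  (∀ (n : ℕ) → n ≡ 3 ⊎ n ≡ 4 →
    ∃ (λ k → IsL0 ((n ∸ 1) ^ 3) (n ^ 3) k)
    × (∀ (k : ℤ) → IsL0 ((n ∸ 1) ^ 3) (n ^ 3) k →
        + ((n !) ^ (2 * n)) ℤ.< k ℤ.* + (n ^ (n * n))))
  ×
  (∀ (n : ℕ) → 5 ≤ n →
    ∃ (λ k → IsL0 ((n ∸ 1) ^ 3) (n ^ 3) k)
    × (∀ (k : ℤ) → IsL0 ((n ∸ 1) ^ 3) (n ^ 3) k →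
        k ℤ.* + (n ^ (n * n)) ℤ.< + ((n !) ^ (2 * n))))
proposition8 =
  (λ { _ (inj₁ refl) → l0-above 8 27 (3 ^ (3 * 3)) (s≤s (s≤s z≤n)) (s≤s z≤n) (<ᵇ⇒< _ _ _)
     ; _ (inj₂ refl) → l0-above 27 64 (4 ^ (4 * 4)) (s≤s (s≤s z≤n)) (s≤s z≤n) (<ᵇ⇒< _ _ _) }) ,
  λ n 5≤n → l0-below ((n ∸ 1) ^ 3) (n ^ 3) (n ^ (n * n))
    (2≤[n∸1]^3 (≤-trans (s≤s (s≤s (s≤s z≤n))) 5≤n))
    (m^n>0 n {{>-nonZero (≤-trans (s≤s z≤n) 5≤n)}} 3)
    (≤-<-trans (*-monoˡ-≤ (n ^ (n * n)) ([n∸1]^k+n^k≤2*n^k n 3)) (2*n^3*n^[n*n]<n!^[2*n] 5≤n))
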